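{- For positive integers $n>d\geq k$, let $\psi(n,d,k)$ be the smallest integer $\psi$ such that every connected $n$-vertex graph with at least $\psi$ vertices of degree at least $d$ contains a path on $k+1$ vertices. Then for every integer $k\geq 7$ there exist infinitely many integers $d$ such that the following holds: there is a constant $c'=c'(d,k)>0$ such that $\psi(n,d,k)>\left(\lfloor\frac{k-3}{4}\rfloor+c'\right)\cdot\frac{n-1}{d}$ for infinitely many integers $n$.
   Context: All graphs are finite and simple; "contains a path on $k+1$ vertices" means has a subgraph isomorphic to the path with $k+1$ vertices. -}

module Defs where

open import Data.Nat using (ℕ; zero; suc; _+_; _*_; _∸_; _≤_; _<_)
open import Data.Nat.DivMod using (_/_)
open import Data.Bool using (Bool; true; false; if_then_else_)
open import Data.Fin using (Fin; zero; suc; inject₁)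
open import Data.Product using (Σ; _×_; _,_)
open import Function.Definitions using (Injective)
open import Relation.Binary.PropositionalEquality using (_≡_)
open import Relation.Nullary using (¬_)
open import Relation.Nullary.Decidable using (⌊_⌋)
open import Data.Nat using (_≤?_)

record Graph (n : ℕ) : Set where
  field
    adj    : Fin n → Fin n → Bool
    sym    : ∀ i j → adj i j ≡ adj j i
    irrefl : ∀ i → adj i i ≡ false
open Graph public

countTrue : {n : ℕ} → (Fin n → Bool) → ℕ
countTrue {zero}  f = 0
countTrue {suc n} f = (if f zero then 1 else 0) + countTrue (λ i → f (suc i))

degree : {n : ℕ} → Graph n → Fin n → ℕ
degree G i = countTrue (adj G i)

numDegAtLeast : {n : ℕ} → Graph n → ℕ → ℕ
numDegAtLeast G d = countTrue (λ i → ⌊ d ≤? degree G i ⌋)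

data Reachable {n : ℕ} (G : Graph n) : Fin n → Fin n → Set where
  here : ∀ {i} → Reachable G i i
  step : ∀ {i j l} → adj G i j ≡ true → Reachable G j l → Reachable G i l

Connected : {n : ℕ} → Graph n → Set
Connected G = ∀ i j → Reachable G i j

HasPath : {n : ℕ} → Graph n → ℕ → Set
HasPath {n} G k =
  Σ (Fin (suc k) → Fin n) λ f →
    Injective _≡_ _≡_ f × (∀ (i : Fin k) → adj G (f (inject₁ i)) (f (suc i)) ≡ true)

PsiGood : ℕ → ℕ → ℕ → ℕ → Set
PsiGood n d k ψ = (G : Graph n) → Connected G → ψ ≤ numDegAtLeast G d → HasPath G k

IsPsi : ℕ → ℕ → ℕ → ℕ → Set
IsPsi n d k ψ = PsiGood n d k ψ × (∀ q → q < ψ → ¬ PsiGood n d k q)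

-- Centre c is joined to M hubs; hub i is joined to the cores of its Q blobs, and blob (i, q) is a
-- clique on t cores together with R leaves joined to every core of the blob.  Hubs and cores have
-- degree at least d = 1 + Q t (the choice R = 1 + P t with Q = 1 + P makes the cores' degree
-- t + R equal to that), so there are M d high-degree vertices among n = 1 + M U, U = 1 + Q (t + R).
-- The centre and the cores cover every edge, so a path with c cover vertices has at most 2c + 1
-- vertices.  A blob is left only through its hub, so a run of a path inside a blob that does not
-- reach an end of the path would visit the hub twice: all cores of a path lie in the blobs of its
-- two end vertices, whence c ≤ 2t + 1 and every path has at most 4t + 3 ≤ k vertices.  Thus
-- ψ > M d, and since t U + 1 ≤ d², this gives ψ d > (t + 1/U)(n - 1) for t = ⌊(k - 3)/4⌋.
module Submission where

open import Data.Bool using (Bool; true; false) renaming (_≟_ to _≟ᵇ_)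
open import Data.Empty using (⊥; ⊥-elim)
open import Data.Fin using (Fin; zero; suc; inject₁; punchIn)
open import Data.Fin.Properties
  using (injective⇒≤; 1↔⊤; +↔⊎; *↔×; _≟_; punchIn-injective; punchInᵢ≢i)
open import Data.List using (List; []; _∷_; _++_; length; lookup; filter; tabulate; allFin)
open import Data.List.Properties using (length-tabulate; length-++; filter-accept; filter-reject)
open import Data.List.Membership.Propositional using (_∈_; _∉_)
open import Data.List.Membership.Propositional.Properties
  using (∈-lookup; ∈-tabulate⁻; ∈-tabulate⁺; ∈-filter⁺; ∈-filter⁻; ∈-allFin; ∈-∃++; ∈-++⁺ˡ; ∈-++⁺ʳ)
open import Data.List.Relation.Binary.Subset.Propositional using (_⊆_)
open import Data.List.Relation.Unary.All as All using (All; []; _∷_)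
open import Data.List.Relation.Unary.All.Properties using (++⁻ʳ)
open import Data.List.Relation.Unary.Any using (here; there; index)
open import Data.List.Relation.Unary.Any.Properties using (lookup-index)
open import Data.List.Relation.Unary.Linked as Linked using (Linked; []; [-]; _∷_)
open import Data.List.Relation.Unary.Unique.Propositional using (Unique; _∷_)
open import Data.List.Relation.Unary.Unique.Propositional.Properties using (tabulate⁺; filter⁺)
open import Data.Nat using (ℕ; zero; suc; _+_; _*_; _∸_; _≤_; _<_; _>_; z≤n; s≤s; _≤?_)
open import Data.Nat.DivMod using (_/_; m/n*n≤m; m≥n⇒m/n>0)
open import Data.Nat.Properties
  using ( ≤-reflexive; ≤-trans; ≤-<-trans; <-irrefl; ≰⇒>; n≤1+n; m≤n⇒m≤1+n; m≤m+n; m≤n+m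
        ; m≤m*n; m≤n*m; +-suc; +-mono-≤; +-monoˡ-≤; *-assoc; *-comm; *-monoˡ-≤; *-monoʳ-≤
        ; *-monoˡ-<; m∸n+n≡m; ∸-monoˡ-≤; module ≤-Reasoning)
open import Data.Nat.Tactic.RingSolver using (solve-∀)
open import Data.Product using (Σ; _×_; _,_)
open import Data.Product.Function.NonDependent.Propositional using (_×-↔_)
open import Data.Sum as Sum using (_⊎_; inj₁; inj₂)
open import Data.Sum.Function.Propositional using (_⊎-↔_)
open import Data.Unit using (⊤; tt)
open import Function using (_∘_)
open import Function.Bundles using (_↔_; Inverse; Injection; mk⇔)
open import Function.Definitions using (Injective)
open import Function.Properties.Inverse using (↔-refl; ↔-sym; ↔⇒↣) renaming (↔-trans to _⨾_)
open import Relation.Binary.PropositionalEquality as ≡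
  using (_≡_; _≢_; refl; cong; subst; subst₂; module ≡-Reasoning)
open import Relation.Nullary using (¬_; Dec; yes; no; does; contradiction; _×-dec_; ¬?)
open import Relation.Nullary.Decidable using (dec-true; dec-false; does-⇔; isYes≗does)
open import Relation.Unary using (Decidable)

open import Defs

private variable
  A B : Set
  m n : ℕ
  x : A

↔-injective : (f : A ↔ B) → Injective _≡_ _≡_ (Inverse.to f)
↔-injective f = Injection.injective (↔⇒↣ f)

Unique⇒lookup-injective : {xs : List A} → Unique xs → Injective _≡_ _≡_ (lookup xs)
Unique⇒lookup-injective (_ ∷ _)  {zero}  {zero}  _  = refl
Unique⇒lookup-injective (x∉ ∷ _) {zero}  {suc j} eq = ⊥-elim (All.lookup x∉ (∈-lookup j) eq)
Unique⇒lookup-injective (x∉ ∷ _) {suc i} {zero}  eq = ⊥-elim (All.lookup x∉ (∈-lookup i) (≡.sym eq))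
Unique⇒lookup-injective (_ ∷ u)  {suc i} {suc j} eq = cong suc (Unique⇒lookup-injective u eq)

Unique⇒length-≤ : {xs ys : List A} → Unique xs → xs ⊆ ys → length xs ≤ length ys
Unique⇒length-≤ {xs = xs} {ys} u xs⊆ys = injective⇒≤ position-injective
  where
  position : Fin (length xs) → Fin (length ys)
  position i = index (xs⊆ys (∈-lookup i))

  position-injective : Injective _≡_ _≡_ position
  position-injective {i} {j} eq = Unique⇒lookup-injective u (begin
    lookup xs i             ≡⟨ lookup-index (xs⊆ys (∈-lookup i)) ⟩
    lookup ys (position i)  ≡⟨ cong (lookup ys) eq ⟩
    lookup ys (position j)  ≡⟨ lookup-index (xs⊆ys (∈-lookup j)) ⟨
    lookup xs j             ∎)
    where open ≡-Reasoning

countTrue-tabulate : (p : A → Bool) (h : Fin n → A) →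
  countTrue (p ∘ h) ≡ length (filter ((_≟ᵇ true) ∘ p) (tabulate h))
countTrue-tabulate {n = zero}  p h = refl
countTrue-tabulate {n = suc n} p h with p (h zero)
... | true  = cong suc (countTrue-tabulate p (h ∘ suc))
... | false = countTrue-tabulate p (h ∘ suc)

injection⇒≤countTrue : (f : Fin n → Bool) (g : Fin m → Fin n) → Injective _≡_ _≡_ g →
  (∀ i → f (g i) ≡ true) → m ≤ countTrue f
injection⇒≤countTrue f g g-injective fg =
  subst₂ _≤_ (length-tabulate g) (≡.sym (countTrue-tabulate f (λ i → i)))
    (Unique⇒length-≤ (tabulate⁺ g-injective) image⊆)
  where
  image⊆ : tabulate g ⊆ filter ((_≟ᵇ true) ∘ f) (allFin _)
  image⊆ x∈ with ∈-tabulate⁻ x∈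
  ... | i , refl = ∈-filter⁺ ((_≟ᵇ true) ∘ f) (∈-allFin (g i)) (fg i)

Linked-tabulate⁺ : {R : A → A → Set} (h : Fin (suc n) → A) →
  (∀ i → R (h (inject₁ i)) (h (suc i))) → Linked R (tabulate h)
Linked-tabulate⁺ {n = zero}  h Rh = [-]
Linked-tabulate⁺ {n = suc n} h Rh = Rh zero ∷ Linked-tabulate⁺ (h ∘ suc) (Rh ∘ suc)

Linked-++⁻ʳ : {R : A → A → Set} → ∀ ys {zs} → Linked R (ys ++ zs) → Linked R zs
Linked-++⁻ʳ []       l = l
Linked-++⁻ʳ (y ∷ ys) l = Linked-++⁻ʳ ys (Linked.tail l)

Unique-++⇒disjoint : ∀ ys {zs} → Unique (ys ++ zs) → x ∈ ys → x ∉ zs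
Unique-++⇒disjoint (y ∷ ys) (y∉ ∷ _) (here refl) x∈zs = All.lookup (++⁻ʳ ys y∉) x∈zs refl
Unique-++⇒disjoint (y ∷ ys) (_ ∷ u)  (there x∈ys)     = Unique-++⇒disjoint ys u x∈ys

lastOf : A → List A → A
lastOf x []       = x
lastOf _ (y ∷ ys) = lastOf y ys

lastOf-++ : ∀ (x : A) ys {v zs} → lastOf x (ys ++ v ∷ zs) ≡ lastOf v zs
lastOf-++ x []       = refl
lastOf-++ x (y ∷ ys) = lastOf-++ y ys

All-lastOf : {P : A → Set} {xs : List A} → P x → All P xs → P (lastOf x xs)
All-lastOf px []         = px
All-lastOf _  (py ∷ pys) = All-lastOf py pys

module _ {R : A → A → Set} {P : A → Set} (P? : Decidable P)
         (cover : ∀ {x y} → R x y → P x ⊎ P y) where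

  private
    count : List A → ℕ
    count xs = length (filter P? xs)

    count-accept : ∀ {x xs} → P x → count (x ∷ xs) ≡ suc (count xs)
    count-accept px = cong length (filter-accept P? px)

    count-reject : ∀ {x xs} → ¬ P x → count (x ∷ xs) ≡ count xs
    count-reject ¬px = cong length (filter-reject P? ¬px)

    regroup : ∀ {l c} → l ≤ suc (c + c) → l ≤ c + suc c
    regroup {c = c} h = ≤-trans h (≤-reflexive (≡.sym (+-suc c c)))

  Linked⇒length≤1+2*count : ∀ {xs} → Linked R xs → length xs ≤ suc (count xs + count xs)
  Linked⇒length≤2*count : ∀ {x xs} → Linked R (x ∷ xs) → P x →
    length (x ∷ xs) ≤ count (x ∷ xs) + count (x ∷ xs)
  length≤1+2*count-by-head : ∀ {x xs} → Dec (P x) → Linked R (x ∷ xs) →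
    length (x ∷ xs) ≤ suc (count (x ∷ xs) + count (x ∷ xs))

  Linked⇒length≤1+2*count []              = z≤n
  Linked⇒length≤1+2*count [-]             = s≤s z≤n
  Linked⇒length≤1+2*count {x ∷ _} (r ∷ l) = length≤1+2*count-by-head (P? x) (r ∷ l)

  length≤1+2*count-by-head (yes px) l   = m≤n⇒m≤1+n (Linked⇒length≤2*count l px)
  length≤1+2*count-by-head (no ¬px) [-] = s≤s z≤n
  length≤1+2*count-by-head {xs = xs} (no ¬px) (r ∷ l) with cover r
  ... | inj₁ px = contradiction px ¬px
  ... | inj₂ py = subst (λ c → suc (length xs) ≤ suc (c + c)) (≡.sym (count-reject ¬px))
                    (s≤s (Linked⇒length≤2*count l py))

  Linked⇒length≤2*count {xs = xs} l px =
    subst (λ c → suc (length xs) ≤ c + c) (≡.sym (count-accept px))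
      (s≤s (regroup (Linked⇒length≤1+2*count (Linked.tail l))))

module _ (G : Graph n) where

  Reachable-trans : ∀ {i j l} → Reachable G i j → Reachable G j l → Reachable G i l
  Reachable-trans here       r′ = r′
  Reachable-trans (step e r) r′ = step e (Reachable-trans r r′)

  Reachable-sym : ∀ {i j} → Reachable G i j → Reachable G j i
  Reachable-sym here               = here
  Reachable-sym (step {i} {j} e r) =
    Reachable-trans (Reachable-sym r) (step (≡.trans (sym G j i) e) here)

  reachable-root⇒connected : (c : Fin n) → (∀ i → Reachable G i c) → Connected G
  reachable-root⇒connected c reach i j = Reachable-trans (reach i) (Reachable-sym (reach j))

PsiGood⇒numDegAtLeast< : ∀ {d k ψ} (G : Graph n) → Connected G → ¬ HasPath G k → PsiGood n d k ψ →
  numDegAtLeast G d < ψ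
PsiGood⇒numDegAtLeast< G connected no-path good = ≰⇒> (no-path ∘ good G connected)

module FromRelation {V : Set} (vertices : Fin n ↔ V) (R : V → V → Set) (R? : ∀ v w → Dec (R v w))
  (R-sym : ∀ {v w} → R v w → R w v) (R-irrefl : ∀ {v} → ¬ R v v) where

  open Inverse vertices using (to; from; strictlyInverseˡ; strictlyInverseʳ)

  graph : Graph n
  graph = record
    { adj    = λ x y → does (R? (to x) (to y))
    ; sym    = λ x y → does-⇔ (mk⇔ R-sym R-sym) (R? (to x) (to y)) (R? (to y) (to x))
    ; irrefl = λ x → dec-false (R? (to x) (to x)) R-irrefl
    }

  adj-from : ∀ {v w} → R v w → adj graph (from v) (from w) ≡ true
  adj-from {v} {w} r rewrite strictlyInverseˡ v | strictlyInverseˡ w = dec-true (R? v w) r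

  adj-to : ∀ {x y} → adj graph x y ≡ true → R (to x) (to y)
  adj-to {x} {y} e with R? (to x) (to y)
  ... | yes r = r

  ≤-degree : ∀ {m v} {X : Set} → Fin m ↔ X → (nb : X → V) → Injective _≡_ _≡_ nb →
    (∀ x → R v (nb x)) → m ≤ degree graph (from v)
  ≤-degree X↔ nb nb-injective r = injection⇒≤countTrue _ (from ∘ nb ∘ Inverse.to X↔)
    (↔-injective X↔ ∘ nb-injective ∘ ↔-injective (↔-sym vertices)) (adj-from ∘ r ∘ Inverse.to X↔)

  ≤-numDegAtLeast : ∀ {m d} {X : Set} → Fin m ↔ X → (h : X → V) → Injective _≡_ _≡_ h →
    (∀ x → d ≤ degree graph (from (h x))) → m ≤ numDegAtLeast graph d
  ≤-numDegAtLeast {d = d} X↔ h h-injective deg = injection⇒≤countTrue _ (from ∘ h ∘ Inverse.to X↔)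
    (↔-injective X↔ ∘ h-injective ∘ ↔-injective (↔-sym vertices))
    (λ x → ≡.trans (isYes≗does (d ≤? _)) (dec-true (d ≤? _) (deg (Inverse.to X↔ x))))

  reach-step : ∀ {v w c} → R v w → Reachable graph (from w) c → Reachable graph (from v) c
  reach-step r = step (adj-from r)

  connected : (c : V) → (∀ v → Reachable graph (from v) (from c)) → Connected graph
  connected c reach = reachable-root⇒connected graph (from c)
    (λ x → subst (λ y → Reachable graph y (from c)) (strictlyInverseʳ x) (reach (to x)))

  HasPath⇒≤ : ∀ {L} → (∀ {ps} → Linked R ps → Unique ps → length ps ≤ L) →
    ∀ {k} → HasPath graph k → suc k ≤ L
  HasPath⇒≤ {L} bound (f , f-injective , f-adj) = subst (_≤ L) (length-tabulate (to ∘ f))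
    (bound (Linked-tabulate⁺ (to ∘ f) (adj-to ∘ f-adj)) (tabulate⁺ (f-injective ∘ ↔-injective vertices)))

module Construction (M Q t′ R : ℕ) where

  t : ℕ
  t = suc t′

  V : Set
  V = ⊤ ⊎ (Fin M × (⊤ ⊎ (Fin Q × (Fin t ⊎ Fin R))))

  pattern centre     = inj₁ tt
  pattern hub i      = inj₂ (i , inj₁ tt)
  pattern core i q j = inj₂ (i , inj₂ (q , inj₁ j))
  pattern leaf i q r = inj₂ (i , inj₂ (q , inj₂ r))

  order : ℕ
  order = suc (M * suc (Q * (t + R)))

  vertices : Fin order ↔ V
  vertices = +↔⊎ ⨾ (1↔⊤ ⊎-↔ (*↔× ⨾ (↔-refl ×-↔ (+↔⊎ ⨾ (1↔⊤ ⊎-↔ (*↔× ⨾ (↔-refl ×-↔ +↔⊎)))))))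

  Adj : V → V → Set
  Adj centre       (hub _)         = ⊤
  Adj (hub _)      centre          = ⊤
  Adj (hub i)      (core i′ _ _)   = i ≡ i′
  Adj (core i _ _) (hub i′)        = i ≡ i′
  Adj (core i q j) (core i′ q′ j′) = i ≡ i′ × q ≡ q′ × j ≢ j′
  Adj (core i q _) (leaf i′ q′ _)  = i ≡ i′ × q ≡ q′
  Adj (leaf i q _) (core i′ q′ _)  = i ≡ i′ × q ≡ q′
  Adj _            _               = ⊥

  Adj? : ∀ v w → Dec (Adj v w)
  Adj? centre       (hub _)         = yes tt
  Adj? (hub _)      centre          = yes tt
  Adj? (hub i)      (core i′ _ _)   = i ≟ i′
  Adj? (core i _ _) (hub i′)        = i ≟ i′
  Adj? (core i q j) (core i′ q′ j′) = i ≟ i′ ×-dec q ≟ q′ ×-dec ¬? (j ≟ j′)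
  Adj? (core i q _) (leaf i′ q′ _)  = i ≟ i′ ×-dec q ≟ q′
  Adj? (leaf i q _) (core i′ q′ _)  = i ≟ i′ ×-dec q ≟ q′
  Adj? centre       centre          = no λ ()
  Adj? centre       (core _ _ _)    = no λ ()
  Adj? centre       (leaf _ _ _)    = no λ ()
  Adj? (hub _)      (hub _)         = no λ ()
  Adj? (hub _)      (leaf _ _ _)    = no λ ()
  Adj? (core _ _ _) centre          = no λ ()
  Adj? (leaf _ _ _) centre          = no λ ()
  Adj? (leaf _ _ _) (hub _)         = no λ ()
  Adj? (leaf _ _ _) (leaf _ _ _)    = no λ ()

  Adj-sym : ∀ {v w} → Adj v w → Adj w v
  Adj-sym {centre}     {hub _}      _                    = tt
  Adj-sym {hub _}      {centre}     _                    = tt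
  Adj-sym {hub _}      {core _ _ _} refl                 = refl
  Adj-sym {core _ _ _} {hub _}      refl                 = refl
  Adj-sym {core _ _ _} {core _ _ _} (refl , refl , j≢j′) = refl , refl , j≢j′ ∘ ≡.sym
  Adj-sym {core _ _ _} {leaf _ _ _} (refl , refl)        = refl , refl
  Adj-sym {leaf _ _ _} {core _ _ _} (refl , refl)        = refl , refl

  Adj-irrefl : ∀ {v} → ¬ Adj v v
  Adj-irrefl {core _ _ _} (_ , _ , j≢j) = j≢j refl

  open FromRelation vertices Adj Adj? Adj-sym Adj-irrefl public using (graph)
  open FromRelation vertices Adj Adj? Adj-sym Adj-irrefl
    using (≤-degree; ≤-numDegAtLeast; reach-step; connected; HasPath⇒≤)
  open Inverse vertices using (from)

  data InBlob (i : Fin M) (q : Fin Q) : V → Set where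
    core∈ : ∀ j → InBlob i q (core i q j)
    leaf∈ : ∀ r → InBlob i q (leaf i q r)

  blob-neighbour : ∀ {i q v w} → Adj v w → InBlob i q w → InBlob i q v ⊎ v ≡ hub i
  blob-neighbour {v = hub _}      refl              (core∈ _) = inj₂ refl
  blob-neighbour {v = core _ _ _} (refl , refl , _) (core∈ _) = inj₁ (core∈ _)
  blob-neighbour {v = leaf _ _ _} (refl , refl)     (core∈ _) = inj₁ (leaf∈ _)
  blob-neighbour {v = core _ _ _} (refl , refl)     (leaf∈ _) = inj₁ (core∈ _)
  blob-neighbour {v = centre}     ()                (core∈ _)
  blob-neighbour {v = centre}     ()                (leaf∈ _)
  blob-neighbour {v = hub _}      ()                (leaf∈ _)
  blob-neighbour {v = leaf _ _ _} ()                (leaf∈ _)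

  run-forward : ∀ {i q v zs} → Linked Adj (v ∷ zs) → InBlob i q v → All (InBlob i q) zs ⊎ hub i ∈ zs
  run-forward [-]     _ = inj₁ []
  run-forward (e ∷ l) b with blob-neighbour (Adj-sym e) b
  ... | inj₁ b′   = Sum.map (b′ ∷_) there (run-forward l b′)
  ... | inj₂ refl = inj₂ (here refl)

  run-backward : ∀ {i q v zs} ys → Linked Adj (ys ++ v ∷ zs) → InBlob i q v →
    All (InBlob i q) ys ⊎ hub i ∈ ys
  run-backward []            _       _ = inj₁ []
  run-backward (y ∷ [])      (e ∷ _) b = Sum.map (_∷ []) (λ { refl → here refl }) (blob-neighbour e b)
  run-backward (y ∷ y′ ∷ ys) (e ∷ l) b with run-backward (y′ ∷ ys) l b
  ... | inj₂ hub∈      = inj₂ (there hub∈)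
  ... | inj₁ (b′ ∷ bs) = Sum.map (_∷ b′ ∷ bs) (λ { refl → here refl }) (blob-neighbour e b′)

  blob-at-an-end : ∀ {i q v zs} ys → Linked Adj (ys ++ v ∷ zs) → Unique (ys ++ v ∷ zs) → InBlob i q v →
    All (InBlob i q) ys ⊎ All (InBlob i q) zs
  blob-at-an-end ys l u b with run-backward ys l b | run-forward (Linked-++⁻ʳ ys l) b
  ... | inj₁ bs     | _           = inj₁ bs
  ... | inj₂ _      | inj₁ bs     = inj₂ bs
  ... | inj₂ hub∈ys | inj₂ hub∈zs = ⊥-elim (Unique-++⇒disjoint ys u hub∈ys (there hub∈zs))

  core-in-end-blob : ∀ {i q j x xs} → Linked Adj (x ∷ xs) → Unique (x ∷ xs) → core i q j ∈ x ∷ xs →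
    InBlob i q x ⊎ InBlob i q (lastOf x xs)
  core-in-end-blob {j = j} l u c∈ with ∈-∃++ c∈
  ... | [] , _ , refl = inj₁ (core∈ j)
  ... | y ∷ ys , _ , refl with blob-at-an-end (y ∷ ys) l u (core∈ j)
  ...   | inj₁ (b ∷ _) = inj₁ b
  ...   | inj₂ bs      = inj₂ (subst (InBlob _ _) (≡.sym (lastOf-++ y ys)) (All-lastOf (core∈ j) bs))

  blobCores : V → List V
  blobCores (core i q _) = tabulate (core i q)
  blobCores (leaf i q _) = tabulate (core i q)
  blobCores _            = []

  core∈blobCores : ∀ {i q v} j → InBlob i q v → core i q j ∈ blobCores v
  core∈blobCores {i} {q} j (core∈ _) = ∈-tabulate⁺ {f = core i q} j
  core∈blobCores {i} {q} j (leaf∈ _) = ∈-tabulate⁺ {f = core i q} j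

  length-blobCores : ∀ v → length (blobCores v) ≤ t
  length-blobCores centre       = z≤n
  length-blobCores (hub _)      = z≤n
  length-blobCores (core i q _) = ≤-reflexive (length-tabulate (core i q))
  length-blobCores (leaf i q _) = ≤-reflexive (length-tabulate (core i q))

  Cover : V → Set
  Cover centre       = ⊤
  Cover (core _ _ _) = ⊤
  Cover _            = ⊥

  cover? : Decidable Cover
  cover? centre       = yes tt
  cover? (hub _)      = no λ ()
  cover? (core _ _ _) = yes tt
  cover? (leaf _ _ _) = no λ ()

  Adj⇒cover : ∀ {v w} → Adj v w → Cover v ⊎ Cover w
  Adj⇒cover {centre}                  _ = inj₁ tt
  Adj⇒cover {core _ _ _}              _ = inj₁ tt
  Adj⇒cover {hub _}      {centre}     _ = inj₂ tt
  Adj⇒cover {hub _}      {core _ _ _} _ = inj₂ tt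
  Adj⇒cover {leaf _ _ _} {core _ _ _} _ = inj₂ tt

  covers⊆ : ∀ {x xs} → Linked Adj (x ∷ xs) → Unique (x ∷ xs) →
    filter cover? (x ∷ xs) ⊆ centre ∷ blobCores x ++ blobCores (lastOf x xs)
  covers⊆ {x} {xs} l u v∈ with ∈-filter⁻ cover? {xs = x ∷ xs} v∈
  covers⊆ l u {centre}     _ | _ = here refl
  covers⊆ {x} l u {core _ _ j} _ | v∈xs , _ =
    there (Sum.[ ∈-++⁺ˡ ∘ core∈blobCores j , ∈-++⁺ʳ (blobCores x) ∘ core∈blobCores j ]′
                 (core-in-end-blob l u v∈xs))

  count-covers≤ : ∀ {x xs} → Linked Adj (x ∷ xs) → Unique (x ∷ xs) →
    length (filter cover? (x ∷ xs)) ≤ suc (t + t)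
  count-covers≤ {x} {xs} l u = begin
    length (filter cover? (x ∷ xs))
      ≤⟨ Unique⇒length-≤ (filter⁺ cover? u) (covers⊆ l u) ⟩
    suc (length (blobCores x ++ blobCores (lastOf x xs)))
      ≡⟨ cong suc (length-++ (blobCores x)) ⟩
    suc (length (blobCores x) + length (blobCores (lastOf x xs)))
      ≤⟨ s≤s (+-mono-≤ (length-blobCores x) (length-blobCores (lastOf x xs))) ⟩
    suc (t + t) ∎
    where open ≤-Reasoning

  path-length≤ : ∀ {ps} → Linked Adj ps → Unique ps → length ps ≤ t * 4 + 3
  path-length≤ {[]}     _ _ = z≤n
  path-length≤ {x ∷ xs} l u = begin
    length (x ∷ xs)                  ≤⟨ Linked⇒length≤1+2*count cover? Adj⇒cover l ⟩
    suc (c + c)                      ≤⟨ s≤s (+-mono-≤ (count-covers≤ l u) (count-covers≤ l u)) ⟩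
    suc (suc (t + t) + suc (t + t))  ≡⟨ 4t+3 t ⟩
    t * 4 + 3                        ∎
    where
    open ≤-Reasoning
    c = length (filter cover? (x ∷ xs))
    4t+3 : ∀ t → suc (suc (t + t) + suc (t + t)) ≡ t * 4 + 3
    4t+3 = solve-∀

  no-long-path : ∀ {k} → t * 4 + 3 ≤ k → ¬ HasPath graph k
  no-long-path 4t+3≤k path = <-irrefl refl (≤-trans (HasPath⇒≤ path-length≤ path) 4t+3≤k)

  hub-reaches-centre : ∀ i → Reachable graph (from (hub i)) (from centre)
  hub-reaches-centre i = reach-step {hub i} {centre} tt here

  core-reaches-centre : ∀ i q j → Reachable graph (from (core i q j)) (from centre)
  core-reaches-centre i q j = reach-step {core i q j} {hub i} refl (hub-reaches-centre i)

  reaches-centre : ∀ v → Reachable graph (from v) (from centre)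
  reaches-centre centre       = here
  reaches-centre (hub i)      = hub-reaches-centre i
  reaches-centre (core i q j) = core-reaches-centre i q j
  reaches-centre (leaf i q r) =
    reach-step {leaf i q r} {core i q zero} (refl , refl) (core-reaches-centre i q zero)

  graph-connected : Connected graph
  graph-connected = connected centre reaches-centre

  hubNeighbour : Fin M → ⊤ ⊎ (Fin Q × Fin t) → V
  hubNeighbour _ (inj₁ tt)      = centre
  hubNeighbour i (inj₂ (q , j)) = core i q j

  hubNeighbour-injective : ∀ i → Injective _≡_ _≡_ (hubNeighbour i)
  hubNeighbour-injective _ {inj₁ tt} {inj₁ tt} _    = refl
  hubNeighbour-injective _ {inj₂ _}  {inj₂ _}  refl = refl
  hubNeighbour-injective _ {inj₁ tt} {inj₂ _}  ()
  hubNeighbour-injective _ {inj₂ _}  {inj₁ tt} ()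

  degree-hub : ∀ i → suc (Q * t) ≤ degree graph (from (hub i))
  degree-hub i = ≤-degree (+↔⊎ ⨾ (1↔⊤ ⊎-↔ *↔×)) (hubNeighbour i) (hubNeighbour-injective i) adjacent
    where
    adjacent : ∀ x → Adj (hub i) (hubNeighbour i x)
    adjacent (inj₁ tt) = tt
    adjacent (inj₂ _)  = refl

  coreNeighbour : Fin M → Fin Q → Fin t → ⊤ ⊎ (Fin t′ ⊎ Fin R) → V
  coreNeighbour i _ _ (inj₁ tt)       = hub i
  coreNeighbour i q j (inj₂ (inj₁ a)) = core i q (punchIn j a)
  coreNeighbour i q _ (inj₂ (inj₂ r)) = leaf i q r

  coreNeighbour-injective : ∀ i q j → Injective _≡_ _≡_ (coreNeighbour i q j)
  coreNeighbour-injective _ _ _ {inj₁ tt}       {inj₁ tt}       _    = refl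
  coreNeighbour-injective _ _ j {inj₂ (inj₁ a)} {inj₂ (inj₁ b)} eq   =
    cong (inj₂ ∘ inj₁) (punchIn-injective j a b (core-index eq))
    where
    core-index : ∀ {i i′ q q′} {j j′ : Fin t} → _≡_ {A = V} (core i q j) (core i′ q′ j′) → j ≡ j′
    core-index refl = refl
  coreNeighbour-injective _ _ _ {inj₂ (inj₂ _)} {inj₂ (inj₂ _)} refl = refl
  coreNeighbour-injective _ _ _ {inj₁ tt}       {inj₂ (inj₁ _)} ()
  coreNeighbour-injective _ _ _ {inj₁ tt}       {inj₂ (inj₂ _)} ()
  coreNeighbour-injective _ _ _ {inj₂ (inj₁ _)} {inj₁ tt}       ()
  coreNeighbour-injective _ _ _ {inj₂ (inj₁ _)} {inj₂ (inj₂ _)} ()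
  coreNeighbour-injective _ _ _ {inj₂ (inj₂ _)} {inj₁ tt}       ()
  coreNeighbour-injective _ _ _ {inj₂ (inj₂ _)} {inj₂ (inj₁ _)} ()

  degree-core : ∀ i q j → suc (t′ + R) ≤ degree graph (from (core i q j))
  degree-core i q j =
    ≤-degree (+↔⊎ ⨾ (1↔⊤ ⊎-↔ +↔⊎)) (coreNeighbour i q j) (coreNeighbour-injective i q j) adjacent
    where
    adjacent : ∀ x → Adj (core i q j) (coreNeighbour i q j x)
    adjacent (inj₁ tt)       = refl
    adjacent (inj₂ (inj₁ a)) = refl , refl , punchInᵢ≢i j a ∘ ≡.sym
    adjacent (inj₂ (inj₂ _)) = refl , refl

  highVertex : Fin M × (⊤ ⊎ (Fin Q × Fin t)) → V
  highVertex (i , inj₁ tt)      = hub i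
  highVertex (i , inj₂ (q , j)) = core i q j

  highVertex-injective : Injective _≡_ _≡_ highVertex
  highVertex-injective {_ , inj₁ tt} {_ , inj₁ tt} refl = refl
  highVertex-injective {_ , inj₂ _}  {_ , inj₂ _}  refl = refl
  highVertex-injective {_ , inj₁ tt} {_ , inj₂ _}  ()
  highVertex-injective {_ , inj₂ _}  {_ , inj₁ tt} ()

  many-high-degree : Q * t ≤ t′ + R → M * suc (Q * t) ≤ numDegAtLeast graph (suc (Q * t))
  many-high-degree Qt≤t′+R =
    ≤-numDegAtLeast (*↔× ⨾ (↔-refl ×-↔ (+↔⊎ ⨾ (1↔⊤ ⊎-↔ *↔×)))) highVertex highVertex-injective high
    where
    high : ∀ x → suc (Q * t) ≤ degree graph (from (highVertex x))
    high (i , inj₁ tt)      = degree-hub i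
    high (i , inj₂ (q , j)) = ≤-trans (s≤s Qt≤t′+R) (degree-core i q j)

quarter-bound : ∀ k → 3 ≤ k → (k ∸ 3) / 4 * 4 + 3 ≤ k
quarter-bound k 3≤k = ≤-trans (+-monoˡ-≤ 3 (m/n*n≤m (k ∸ 3) 4)) (≤-reflexive (m∸n+n≡m 3≤k))

quarter-positive : ∀ {k} → 7 ≤ k → 0 < (k ∸ 3) / 4
quarter-positive 7≤k = m≥n⇒m/n>0 (∸-monoˡ-≤ 3 7≤k)

square-excess : ∀ t P →
  t * suc (suc P * (t + suc (P * t))) + 1 + t * P ≡ suc (suc P * t) * suc (suc P * t)
square-excess = solve-∀

module Parameters (t′ P : ℕ) where

  t Q R d U : ℕ
  t = suc t′
  Q = suc P
  R = suc (P * t)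
  d = suc (Q * t)
  U = suc (Q * (t + R))

  Qt≤t′+R : Q * t ≤ t′ + R
  Qt≤t′+R = ≤-reflexive (≡.sym (+-suc t′ (P * t)))

  P≤d : P ≤ d
  P≤d = ≤-trans (m≤m*n P t) (≤-trans (m≤n+m (P * t) t) (n≤1+n (Q * t)))

  d≤U : d ≤ U
  d≤U = s≤s (*-monoʳ-≤ Q (m≤m+n t R))

  ψ-inequality : ∀ M ψ → M * d < ψ → (t * U + 1) * (M * U) < ψ * d * U
  ψ-inequality M ψ Md<ψ = begin-strict
    (t * U + 1) * (M * U)  ≡⟨ *-assoc (t * U + 1) M U ⟨
    (t * U + 1) * M * U    ≡⟨ cong (_* U) (*-comm (t * U + 1) M) ⟩
    M * (t * U + 1) * U    ≤⟨ *-monoˡ-≤ U (*-monoʳ-≤ M tU+1≤d²) ⟩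
    M * (d * d) * U        ≡⟨ cong (_* U) (*-assoc M d d) ⟨
    M * d * d * U          <⟨ *-monoˡ-< U (*-monoˡ-< d Md<ψ) ⟩
    ψ * d * U              ∎
    where
    open ≤-Reasoning
    tU+1≤d² : t * U + 1 ≤ d * d
    tU+1≤d² = ≤-trans (m≤m+n (t * U + 1) (t * P)) (≤-reflexive (square-excess t P))

ψ-lower-bound : ∀ t′ D k → suc t′ * 4 + 3 ≤ k →
  Σ ℕ λ d → D ≤ d × k ≤ d ×
    Σ ℕ λ a → Σ ℕ λ b → 1 ≤ a × 1 ≤ b ×
      ((N : ℕ) → Σ ℕ λ n → N ≤ n × d < n ×
        ((ψ : ℕ) → IsPsi n d k ψ → ψ * d * b > (suc t′ * b + a) * (n ∸ 1)))
ψ-lower-bound t′ D k 4t+3≤k =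
  d , ≤-trans (m≤m+n D k) P≤d , ≤-trans (m≤n+m k D) P≤d , 1 , U , s≤s z≤n , s≤s z≤n ,
  λ N → let open Construction (suc N) Q t′ R in
    order , ≤-trans (n≤1+n N) (≤-trans (m≤m*n (suc N) U) (n≤1+n _)) ,
    s≤s (≤-trans d≤U (m≤n*m U (suc N))) ,
    λ ψ (good , _) → ψ-inequality (suc N) ψ (≤-<-trans (many-high-degree Qt≤t′+R)
      (PsiGood⇒numDegAtLeast< {d = d} graph graph-connected (no-long-path 4t+3≤k) good))
  where open Parameters t′ (D + k)

proposition5p2 :
    (k : ℕ) → 7 ≤ k →
    (D : ℕ) → Σ ℕ λ d → D ≤ d × k ≤ d ×
      Σ ℕ λ a → Σ ℕ λ b → 1 ≤ a × 1 ≤ b ×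
        ((N : ℕ) → Σ ℕ λ n → N ≤ n × d < n ×
          ((ψ : ℕ) → IsPsi n d k ψ →
            ψ * d * b > ((k ∸ 3) / 4 * b + a) * (n ∸ 1)))
proposition5p2 k 7≤k D
  with (k ∸ 3) / 4 | quarter-bound k (≤-trans (s≤s (s≤s (s≤s z≤n))) 7≤k) | quarter-positive 7≤k
... | suc t′ | 4t+3≤k | _ = ψ-lower-bound t′ D k 4t+3≤k
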